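{- Let $G$ be a connected $4$-regular graph that is not $2$-connected. Then $G=(G_1,e_1)+(G_2,e_2)$ for some vertex-disjoint $4$-regular graphs $G_1$, $G_2$ and edges $e_1\in E(G_1)$, $e_2\in E(G_2)$.
   Context: All graphs are finite, undirected pseudographs (multiple edges and loops allowed; a loop contributes $2$ to the degree). Edge adhesion: for vertex-disjoint graphs $G_1,G_2$ and edges $e_1=u_1v_1\in E(G_1)$, $e_2=u_2v_2\in E(G_2)$ (loops allowed as $e_i$), the graph $(G_1,e_1)+(G_2,e_2)$ has vertex set $V(G_1)\cup V(G_2)\cup\{w\}$ ($w$ new) and edge set $(E(G_1)\setminus\{e_1\})\cup(E(G_2)\setminus\{e_2\})\cup\{u_1w,v_1w,u_2w,v_2w\}$. -}

module Defs where

open import Data.Nat using (ℕ; zero; suc; _+_)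
open import Data.Fin using (Fin; zero; suc; _↑ˡ_; _↑ʳ_; splitAt; punchIn; _≟_)
open import Data.Fin.Properties using ()
open import Data.Product using (Σ; _×_; _,_; proj₁; proj₂)
open import Data.Sum using (_⊎_; inj₁; inj₂)
open import Data.Unit using (⊤)
open import Data.Bool using (if_then_else_)
open import Data.List using (map; allFin)
open import Data.Nat.ListAction using (sum)
open import Relation.Nullary using (¬_)
open import Relation.Nullary.Decidable using (⌊_⌋)
open import Relation.Binary.PropositionalEquality using (_≡_; _≢_)
open import Function.Bundles using (_↔_; Inverse)

-- A finite pseudograph: vertices Fin n, edges Fin m, each edge has an
-- (unordered) pair of endpoints, stored as an ordered pair; loops are
-- edges whose two ends coincide; parallel edges are distinct indices.
record Graph : Set where
  field
    n    : ℕ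
    m    : ℕ
    ends : Fin m → Fin n × Fin n
open Graph public

ind : ∀ {k} → Fin k → Fin k → ℕ
ind a v = if ⌊ a ≟ v ⌋ then 1 else 0

-- degree: each edge contributes the number of its ends equal to v
-- (so a loop contributes 2)
deg : (G : Graph) → Fin (n G) → ℕ
deg G v = sum (map (λ e → ind (proj₁ (ends G e)) v + ind (proj₂ (ends G e)) v)
                   (allFin (m G)))

Regular : ℕ → Graph → Set
Regular k G = ∀ v → deg G v ≡ k

Adj : (G : Graph) → Fin (n G) → Fin (n G) → Set
Adj G x z = Σ (Fin (m G)) λ e → (ends G e ≡ (x , z)) ⊎ (ends G e ≡ (z , x))

-- walks from x to y all of whose vertices after x satisfy P
data Reach (G : Graph) (P : Fin (n G) → Set) : Fin (n G) → Fin (n G) → Set where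
  here : ∀ {x} → Reach G P x x
  step : ∀ {x z y} → Adj G x z → P z → Reach G P z y → Reach G P x y

ConnectedOn : (G : Graph) → (Fin (n G) → Set) → Set
ConnectedOn G P = ∀ x y → P x → P y → Reach G P x y

Connected : Graph → Set
Connected G = ConnectedOn G (λ _ → ⊤)

TwoConnected : Graph → Set
TwoConnected G = Connected G × (∀ v → ConnectedOn G (λ x → x ≢ v))

record _≅_ (G H : Graph) : Set where
  field
    vmap : Fin (n G) ↔ Fin (n H)
    emap : Fin (m G) ↔ Fin (m H)
    pres : ∀ e →
      let f = Inverse.to vmap
          a = proj₁ (ends G e)
          b = proj₂ (ends G e)
      in (ends H (Inverse.to emap e) ≡ (f a , f b))
         ⊎ (ends H (Inverse.to emap e) ≡ (f b , f a))

-- Vertices: Fin (suc (n1 + n2)); zero is the new vertex w,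
--   G1-vertex i ↦ suc (i ↑ˡ n2), G2-vertex j ↦ suc (n1 ↑ʳ j).
-- Edges: Fin ((k1 + k2) + 4) where m1 = suc k1, m2 = suc k2;
--   the first k1 are the G1-edges other than e1 (via punchIn e1),
--   the next k2 the G2-edges other than e2 (via punchIn e2),
--   the last 4 are u1w, v1w, u2w, v2w.
adhesionRaw : (n1 m1 : ℕ) → (Fin m1 → Fin n1 × Fin n1) → Fin m1 →
              (n2 m2 : ℕ) → (Fin m2 → Fin n2 × Fin n2) → Fin m2 → Graph
adhesionRaw n1 zero ends1 () n2 m2 ends2 e2
adhesionRaw n1 (suc k1) ends1 e1 n2 zero ends2 ()
adhesionRaw n1 (suc k1) ends1 e1 n2 (suc k2) ends2 e2 = record
  { n = suc (n1 + n2)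
  ; m = (k1 + k2) + 4
  ; ends = E
  }
  where
    ι₁ : Fin n1 → Fin (suc (n1 + n2))
    ι₁ i = suc (i ↑ˡ n2)
    ι₂ : Fin n2 → Fin (suc (n1 + n2))
    ι₂ j = suc (n1 ↑ʳ j)
    w : Fin (suc (n1 + n2))
    w = zero
    old : Fin (k1 + k2) → Fin (suc (n1 + n2)) × Fin (suc (n1 + n2))
    old e with splitAt k1 e
    ... | inj₁ i = ι₁ (proj₁ (ends1 (punchIn e1 i))) , ι₁ (proj₂ (ends1 (punchIn e1 i)))
    ... | inj₂ j = ι₂ (proj₁ (ends2 (punchIn e2 j))) , ι₂ (proj₂ (ends2 (punchIn e2 j)))
    new : Fin 4 → Fin (suc (n1 + n2)) × Fin (suc (n1 + n2))
    new zero = ι₁ (proj₁ (ends1 e1)) , w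
    new (suc zero) = ι₁ (proj₂ (ends1 e1)) , w
    new (suc (suc zero)) = ι₂ (proj₁ (ends2 e2)) , w
    new (suc (suc (suc zero))) = ι₂ (proj₂ (ends2 e2)) , w
    E : Fin ((k1 + k2) + 4) → Fin (suc (n1 + n2)) × Fin (suc (n1 + n2))
    E e with splitAt (k1 + k2) e
    ... | inj₁ o = old o
    ... | inj₂ f = new f

adhesion : (G1 : Graph) → Fin (m G1) → (G2 : Graph) → Fin (m G2) → Graph
adhesion G1 e1 G2 e2 = adhesionRaw (n G1) (m G1) (ends G1) e1 (n G2) (m G2) (ends G2) e2

-- Let v be a cut vertex and split the remaining vertices into the component C of G − v
-- containing some x ≠ v, and the rest D; no edge joins C to D. Counting edge ends in C,
-- 4|C| = 2·e(C) + e(C,v), so the number of edges between C and v is even, and it is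
-- positive since G is connected; likewise for D. As 4 = deg v = 2·(loops at v) + e(C,v) + e(D,v),
-- both numbers are 2 and there is no loop at v. Hence G is the adhesion of G[C] and G[D],
-- each completed by an edge joining the ends of the two edges from v into that side. The two
-- pieces are 4-regular because adhesion does not change the degrees of the old vertices.
module Submission where

open import Defs
open import Level using (Level; 0ℓ)
open import Data.Bool using (if_then_else_)
open import Data.Nat using (ℕ; zero; suc; _+_; _*_; _≤_; _<_; s≤s; z≤n)
open import Data.Nat.Properties
  using ( +-0-commutativeMonoid; +-*-semiring; +-assoc; +-comm; +-identityʳ; *-identityˡ; *-distribʳ-+
        ; *-assoc; m≤m+n; m≤n+m; ≤-trans; ≤-reflexive; <⇒≱; +-suc; +-monoʳ-≤
        ; even≢odd; +-cancelˡ-≡; m+n≡0⇒m≡0; m+n≡0⇒n≡0 )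
open import Data.Nat.Tactic.RingSolver using (solve-∀)
import Data.Nat.ListAction as List
open import Data.Fin using (Fin; zero; suc; _↑ˡ_; _↑ʳ_; punchIn; splitAt)
open import Data.Fin.Properties
  using ( _≟_; any?; suc-injective; ↑ˡ-injective; ↑ʳ-injective
        ; splitAt-↑ˡ; splitAt-↑ʳ; splitAt⁻¹-↑ˡ; splitAt⁻¹-↑ʳ )
open import Data.Fin.Subset using (Subset; _∈_; _∉_; _⊆_; _∪_; ∣_∣)
open import Data.Fin.Subset.Properties
  using (_∈?_; _⊂?_; ∣p∣≤n; p⊂q⇒∣p∣<∣q∣; p⊆p∪q; q⊆p∪q; x∈p∪q⁻; x∈⁅x⁆; x∈⁅y⁆⇒x≡y)
open import Data.Vec using (tabulate)
open import Data.Vec.Properties using (lookup∘tabulate; []=⇒lookup; lookup⇒[]=)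
open import Data.List using (map; allFin)
open import Data.List.Properties using (map-tabulate)
open import Data.Product using (Σ; ∃; ∃-syntax; _×_; _,_; proj₁; proj₂)
import Data.Product as Product
open import Data.Sum using (_⊎_; inj₁; inj₂; [_,_])
open import Data.Unit using (tt)
import Data.Empty.Irrelevant as Irrelevant
open import Function using (_∘_; Injective)
open import Function.Bundles using (_↔_; Inverse; Injection; mk↔ₛ′)
open import Function.Properties.Inverse using (↔⇒↣)
open import Relation.Nullary using (¬_; Dec; yes; no; does; ¬?; _×-dec_; _⊎-dec_; contradiction; map′)
open import Relation.Nullary.Decidable using (dec-true; dec-false; decidable-stable)
open import Relation.Unary using (Pred; Decidable)
open import Relation.Binary.Definitions using (DecidableEquality)
open import Relation.Binary.PropositionalEquality hiding ([_])
open import Algebra.Properties.CommutativeMonoid.Sum +-0-commutativeMonoid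
  using (sum-syntax; sum-cong-≗; ∑-distrib-+; ∑-comm; ∑-permute; sum-remove; sum-replicate-zero)
open import Algebra.Properties.Semiring.Sum +-*-semiring using (*-distribˡ-sum; *-distribʳ-sum)

private variable ℓ : Level

∑-allFin : ∀ n (f : Fin n → ℕ) → List.sum (map f (allFin n)) ≡ ∑[ i < n ] f i
∑-allFin n f = trans (cong List.sum (map-tabulate (λ i → i) f)) (go n f)
  where
    go : ∀ n (f : Fin n → ℕ) → List.sum (Data.List.tabulate f) ≡ ∑[ i < n ] f i
    go zero f = refl
    go (suc n) f = cong (f zero +_) (go n (f ∘ suc))

∑-split : ∀ m n (f : Fin (m + n) → ℕ) →
  ∑[ j < m + n ] f j ≡ ∑[ i < m ] f (i ↑ˡ n) + ∑[ i < n ] f (m ↑ʳ i)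
∑-split zero n f = refl
∑-split (suc m) n f =
  trans (cong (f zero +_) (∑-split m n (f ∘ suc))) (sym (+-assoc (f zero) _ _))

term≤∑ : ∀ {n} (f : Fin n → ℕ) i → f i ≤ ∑[ j < n ] f j
term≤∑ f zero = m≤m+n _ _
term≤∑ f (suc i) = ≤-trans (term≤∑ (f ∘ suc) i) (m≤n+m _ _)

ind-refl : ∀ {n} (a : Fin n) → ind a a ≡ 1
ind-refl a with a ≟ a
... | yes _ = refl
... | no a≢a = contradiction refl a≢a

ind-≢ : ∀ {n} {a b : Fin n} → a ≢ b → ind a b ≡ 0
ind-≢ {a = a} {b} a≢b with a ≟ b
... | yes a≡b = contradiction a≡b a≢b
... | no _ = refl

ind-injective : ∀ {m n} {f : Fin m → Fin n} → Injective _≡_ _≡_ f → ∀ a b → ind (f a) (f b) ≡ ind a b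
ind-injective {f = f} f-inj a b with a ≟ b
... | yes refl = ind-refl (f a)
... | no a≢b = ind-≢ (a≢b ∘ f-inj)

∑-ind : ∀ {n} (g : Fin n → ℕ) a → ∑[ u < n ] (ind a u * g u) ≡ g a
∑-ind {suc n} g zero = trans (cong₂ _+_ (*-identityˡ (g zero)) (sum-replicate-zero n)) (+-identityʳ _)
∑-ind {suc n} g (suc a) =
  trans (sum-cong-≗ (λ u → cong (_* g (suc u)) (ind-injective suc-injective a u)))
        (∑-ind (g ∘ suc) a)

-- Unlike Defs.ind, which goes through ⌊_⌋ and so gets stuck on map′, 𝟙 reads off `does`;
-- this makes the per-edge identities for EdgeType below hold by computation.
𝟙 : {A : Set ℓ} → Dec A → ℕ
𝟙 a? = if does a? then 1 else 0

count : ∀ {n} {P : Pred (Fin n) ℓ} → Decidable P → ℕ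
count {n = n} P? = ∑[ i < n ] 𝟙 (P? i)

incidence : (G : Graph) → Fin (m G) → Fin (n G) → ℕ
incidence G e u = ind (proj₁ (ends G e)) u + ind (proj₂ (ends G e)) u

deg-∑ : ∀ G u → deg G u ≡ ∑[ e < m G ] incidence G e u
deg-∑ G u = ∑-allFin (m G) (λ e → incidence G e u)

incidence-ends : ∀ H e {x y} u → ends H e ≡ (x , y) → incidence H e u ≡ ind x u + ind y u
incidence-ends H e u eq = cong (λ p → ind (proj₁ p) u + ind (proj₂ p) u) eq

weighted-handshake : ∀ G (f : Fin (n G) → ℕ) →
  ∑[ u < n G ] (deg G u * f u) ≡ ∑[ e < m G ] (f (proj₁ (ends G e)) + f (proj₂ (ends G e)))
weighted-handshake G f = begin
  ∑[ u < n G ] (deg G u * f u)                        ≡⟨ sum-cong-≗ (λ u → cong (_* f u) (deg-∑ G u)) ⟩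
  ∑[ u < n G ] (∑[ e < m G ] incidence G e u * f u)   ≡⟨ sum-cong-≗ (λ u → *-distribʳ-sum (f u) (λ e → incidence G e u)) ⟩
  ∑[ u < n G ] ∑[ e < m G ] (incidence G e u * f u)   ≡⟨ ∑-comm (λ u e → incidence G e u * f u) ⟩
  ∑[ e < m G ] ∑[ u < n G ] (incidence G e u * f u)   ≡⟨ sum-cong-≗ weigh-ends ⟩
  ∑[ e < m G ] (f (proj₁ (ends G e)) + f (proj₂ (ends G e))) ∎
  where
    open ≡-Reasoning
    weigh-ends : ∀ e → ∑[ u < n G ] (incidence G e u * f u) ≡ f (proj₁ (ends G e)) + f (proj₂ (ends G e))
    weigh-ends e = begin
      ∑[ u < n G ] ((ind x u + ind y u) * f u)                    ≡⟨ sum-cong-≗ (λ u → *-distribʳ-+ (f u) (ind x u) (ind y u)) ⟩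
      ∑[ u < n G ] (ind x u * f u + ind y u * f u)                ≡⟨ ∑-distrib-+ (λ u → ind x u * f u) (λ u → ind y u * f u) ⟩
      ∑[ u < n G ] (ind x u * f u) + ∑[ u < n G ] (ind y u * f u) ≡⟨ cong₂ _+_ (∑-ind f x) (∑-ind f y) ⟩
      f x + f y                                                   ∎
      where
        x = proj₁ (ends G e)
        y = proj₂ (ends G e)

deg-≅ : ∀ {G H} (iso : G ≅ H) u → deg H (Inverse.to (_≅_.vmap iso) u) ≡ deg G u
deg-≅ {G} {H} iso u = begin
  deg H (σ u)                           ≡⟨ deg-∑ H (σ u) ⟩
  ∑[ e < m H ] incidence H e (σ u)       ≡⟨ ∑-permute _ emap ⟩
  ∑[ e < m G ] incidence H (τ e) (σ u)   ≡⟨ sum-cong-≗ incidence-τ ⟩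
  ∑[ e < m G ] incidence G e u           ≡⟨ deg-∑ G u ⟨
  deg G u                                ∎
  where
    open ≡-Reasoning
    open _≅_ iso
    σ = Inverse.to vmap
    τ = Inverse.to emap
    ind-σ : ∀ a → ind (σ a) (σ u) ≡ ind a u
    ind-σ a = ind-injective (Injection.injective (↔⇒↣ vmap)) a u
    incidence-τ : ∀ e → incidence H (τ e) (σ u) ≡ incidence G e u
    incidence-τ e with pres e
    ... | inj₁ eq = trans (incidence-ends H (τ e) (σ u) eq) (cong₂ _+_ (ind-σ x) (ind-σ y))
      where x = proj₁ (ends G e); y = proj₂ (ends G e)
    ... | inj₂ eq = trans (incidence-ends H (τ e) (σ u) eq)
                          (trans (+-comm (ind (σ y) (σ u)) _) (cong₂ _+_ (ind-σ x) (ind-σ y)))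
      where x = proj₁ (ends G e); y = proj₂ (ends G e)

-- Edge adhesion

module Adhesion (n₁ k₁ : ℕ) (ends₁ : Fin (suc k₁) → Fin n₁ × Fin n₁) (e₁ : Fin (suc k₁))
                (n₂ k₂ : ℕ) (ends₂ : Fin (suc k₂) → Fin n₂ × Fin n₂) (e₂ : Fin (suc k₂)) where

  G₁ G₂ A : Graph
  G₁ = record { n = n₁ ; m = suc k₁ ; ends = ends₁ }
  G₂ = record { n = n₂ ; m = suc k₂ ; ends = ends₂ }
  A = adhesion G₁ e₁ G₂ e₂

  ι₁ : Fin n₁ → Fin (n A)
  ι₁ i = suc (i ↑ˡ n₂)

  ι₂ : Fin n₂ → Fin (n A)
  ι₂ j = suc (n₁ ↑ʳ j)

  newEdgeEnd : Fin 4 → Fin (n A)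
  newEdgeEnd zero                   = ι₁ (proj₁ (ends₁ e₁))
  newEdgeEnd (suc zero)             = ι₁ (proj₂ (ends₁ e₁))
  newEdgeEnd (suc (suc zero))       = ι₂ (proj₁ (ends₂ e₂))
  newEdgeEnd (suc (suc (suc zero))) = ι₂ (proj₂ (ends₂ e₂))

  ends-old₁ : ∀ i → ends A ((i ↑ˡ k₂) ↑ˡ 4) ≡ Product.map ι₁ ι₁ (ends₁ (punchIn e₁ i))
  ends-old₁ i rewrite splitAt-↑ˡ (k₁ + k₂) (i ↑ˡ k₂) 4 | splitAt-↑ˡ k₁ i k₂ = refl

  ends-old₂ : ∀ j → ends A ((k₁ ↑ʳ j) ↑ˡ 4) ≡ Product.map ι₂ ι₂ (ends₂ (punchIn e₂ j))
  ends-old₂ j rewrite splitAt-↑ˡ (k₁ + k₂) (k₁ ↑ʳ j) 4 | splitAt-↑ʳ k₁ k₂ j = refl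

  ends-new : ∀ f → ends A ((k₁ + k₂) ↑ʳ f) ≡ (newEdgeEnd f , zero)
  ends-new f rewrite splitAt-↑ʳ (k₁ + k₂) 4 f with f
  ... | zero                 = refl
  ... | suc zero             = refl
  ... | suc (suc zero)       = refl
  ... | suc (suc (suc zero)) = refl

  ι₁-injective : Injective _≡_ _≡_ ι₁
  ι₁-injective eq = ↑ˡ-injective n₂ _ _ (suc-injective eq)

  ι₂-injective : Injective _≡_ _≡_ ι₂
  ι₂-injective eq = ↑ʳ-injective n₁ _ _ (suc-injective eq)

  ι₁≢ι₂ : ∀ a b → ι₁ a ≢ ι₂ b
  ι₁≢ι₂ a b eq with trans (sym (splitAt-↑ˡ n₁ a n₂)) (trans (cong (splitAt n₁) (suc-injective eq)) (splitAt-↑ʳ n₁ n₂ b))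
  ... | ()

  ind-ι₁ : ∀ a b → ind (ι₁ a) (ι₁ b) ≡ ind a b
  ind-ι₁ = ind-injective ι₁-injective

  ind-ι₂ : ∀ a b → ind (ι₂ a) (ι₂ b) ≡ ind a b
  ind-ι₂ = ind-injective ι₂-injective

  ind-ι₁-ι₂ : ∀ a b → ind (ι₁ a) (ι₂ b) ≡ 0
  ind-ι₁-ι₂ a b = ind-≢ (ι₁≢ι₂ a b)

  ind-ι₂-ι₁ : ∀ a b → ind (ι₂ a) (ι₁ b) ≡ 0
  ind-ι₂-ι₁ a b = ind-≢ (ι₁≢ι₂ b a ∘ sym)

  incidence-old₁-ι₁ : ∀ o i → incidence A ((o ↑ˡ k₂) ↑ˡ 4) (ι₁ i) ≡ incidence G₁ (punchIn e₁ o) i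
  incidence-old₁-ι₁ o i = trans (incidence-ends A ((o ↑ˡ k₂) ↑ˡ 4) (ι₁ i) (ends-old₁ o))
    (cong₂ _+_ (ind-ι₁ (proj₁ (ends₁ (punchIn e₁ o))) i) (ind-ι₁ (proj₂ (ends₁ (punchIn e₁ o))) i))

  incidence-old₂-ι₁ : ∀ o i → incidence A ((k₁ ↑ʳ o) ↑ˡ 4) (ι₁ i) ≡ 0
  incidence-old₂-ι₁ o i = trans (incidence-ends A ((k₁ ↑ʳ o) ↑ˡ 4) (ι₁ i) (ends-old₂ o))
    (cong₂ _+_ (ind-ι₂-ι₁ (proj₁ (ends₂ (punchIn e₂ o))) i) (ind-ι₂-ι₁ (proj₂ (ends₂ (punchIn e₂ o))) i))

  incidence-old₁-ι₂ : ∀ o j → incidence A ((o ↑ˡ k₂) ↑ˡ 4) (ι₂ j) ≡ 0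
  incidence-old₁-ι₂ o j = trans (incidence-ends A ((o ↑ˡ k₂) ↑ˡ 4) (ι₂ j) (ends-old₁ o))
    (cong₂ _+_ (ind-ι₁-ι₂ (proj₁ (ends₁ (punchIn e₁ o))) j) (ind-ι₁-ι₂ (proj₂ (ends₁ (punchIn e₁ o))) j))

  incidence-old₂-ι₂ : ∀ o j → incidence A ((k₁ ↑ʳ o) ↑ˡ 4) (ι₂ j) ≡ incidence G₂ (punchIn e₂ o) j
  incidence-old₂-ι₂ o j = trans (incidence-ends A ((k₁ ↑ʳ o) ↑ˡ 4) (ι₂ j) (ends-old₂ o))
    (cong₂ _+_ (ind-ι₂ (proj₁ (ends₂ (punchIn e₂ o))) j) (ind-ι₂ (proj₂ (ends₂ (punchIn e₂ o))) j))

  incidence-new-ι₁ : ∀ i → ∑[ f < 4 ] incidence A ((k₁ + k₂) ↑ʳ f) (ι₁ i) ≡ incidence G₁ e₁ i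
  incidence-new-ι₁ i = begin
    ∑[ f < 4 ] incidence A ((k₁ + k₂) ↑ʳ f) (ι₁ i)
      ≡⟨ sum-cong-≗ (λ f → trans (incidence-ends A ((k₁ + k₂) ↑ʳ f) (ι₁ i) (ends-new f)) (+-identityʳ _)) ⟩
    ∑[ f < 4 ] ind (newEdgeEnd f) (ι₁ i)
      ≡⟨ cong₂ _+_ (ind-ι₁ x i) (cong₂ _+_ (ind-ι₁ y i) (cong₂ _+_ (ind-ι₂-ι₁ z i) (cong (_+ 0) (ind-ι₂-ι₁ w i)))) ⟩
    ind x i + (ind y i + 0) ≡⟨ cong (ind x i +_) (+-identityʳ (ind y i)) ⟩
    incidence G₁ e₁ i       ∎
    where
      open ≡-Reasoning
      x = proj₁ (ends₁ e₁); y = proj₂ (ends₁ e₁); z = proj₁ (ends₂ e₂); w = proj₂ (ends₂ e₂)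

  incidence-new-ι₂ : ∀ j → ∑[ f < 4 ] incidence A ((k₁ + k₂) ↑ʳ f) (ι₂ j) ≡ incidence G₂ e₂ j
  incidence-new-ι₂ j = begin
    ∑[ f < 4 ] incidence A ((k₁ + k₂) ↑ʳ f) (ι₂ j)
      ≡⟨ sum-cong-≗ (λ f → trans (incidence-ends A ((k₁ + k₂) ↑ʳ f) (ι₂ j) (ends-new f)) (+-identityʳ _)) ⟩
    ∑[ f < 4 ] ind (newEdgeEnd f) (ι₂ j)
      ≡⟨ cong₂ _+_ (ind-ι₁-ι₂ x j) (cong₂ _+_ (ind-ι₁-ι₂ y j) (cong₂ _+_ (ind-ι₂ z j) (cong (_+ 0) (ind-ι₂ w j)))) ⟩
    ind z j + (ind w j + 0) ≡⟨ cong (ind z j +_) (+-identityʳ (ind w j)) ⟩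
    incidence G₂ e₂ j       ∎
    where
      open ≡-Reasoning
      x = proj₁ (ends₁ e₁); y = proj₂ (ends₁ e₁); z = proj₁ (ends₂ e₂); w = proj₂ (ends₂ e₂)

  deg-ι₁ : ∀ i → deg A (ι₁ i) ≡ deg G₁ i
  deg-ι₁ i = begin
    deg A (ι₁ i)                                               ≡⟨ deg-∑ A (ι₁ i) ⟩
    ∑[ j < (k₁ + k₂) + 4 ] incidence A j (ι₁ i)                ≡⟨ ∑-split (k₁ + k₂) 4 _ ⟩
    ∑[ o < k₁ + k₂ ] incidence A (o ↑ˡ 4) (ι₁ i) + new        ≡⟨ cong (_+ new) (∑-split k₁ k₂ _) ⟩
    (∑[ o < k₁ ] incidence A ((o ↑ˡ k₂) ↑ˡ 4) (ι₁ i) + ∑[ o < k₂ ] incidence A ((k₁ ↑ʳ o) ↑ˡ 4) (ι₁ i)) + new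
      ≡⟨ cong₂ _+_ (cong₂ _+_ (sum-cong-≗ (λ o → incidence-old₁-ι₁ o i))
                              (trans (sum-cong-≗ (λ o → incidence-old₂-ι₁ o i)) (sum-replicate-zero k₂)))
                   (incidence-new-ι₁ i) ⟩
    (old + 0) + incidence G₁ e₁ i                              ≡⟨ cong (_+ incidence G₁ e₁ i) (+-identityʳ old) ⟩
    old + incidence G₁ e₁ i                                    ≡⟨ +-comm old (incidence G₁ e₁ i) ⟩
    incidence G₁ e₁ i + old                                    ≡⟨ sum-remove (λ e → incidence G₁ e i) ⟨
    ∑[ e < suc k₁ ] incidence G₁ e i                           ≡⟨ deg-∑ G₁ i ⟨
    deg G₁ i                                                   ∎
    where
      open ≡-Reasoning
      new = ∑[ f < 4 ] incidence A ((k₁ + k₂) ↑ʳ f) (ι₁ i)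
      old = ∑[ o < k₁ ] incidence G₁ (punchIn e₁ o) i

  deg-ι₂ : ∀ j → deg A (ι₂ j) ≡ deg G₂ j
  deg-ι₂ j = begin
    deg A (ι₂ j)                                               ≡⟨ deg-∑ A (ι₂ j) ⟩
    ∑[ i < (k₁ + k₂) + 4 ] incidence A i (ι₂ j)                ≡⟨ ∑-split (k₁ + k₂) 4 _ ⟩
    ∑[ o < k₁ + k₂ ] incidence A (o ↑ˡ 4) (ι₂ j) + new        ≡⟨ cong (_+ new) (∑-split k₁ k₂ _) ⟩
    (∑[ o < k₁ ] incidence A ((o ↑ˡ k₂) ↑ˡ 4) (ι₂ j) + ∑[ o < k₂ ] incidence A ((k₁ ↑ʳ o) ↑ˡ 4) (ι₂ j)) + new
      ≡⟨ cong₂ _+_ (cong₂ _+_ (trans (sum-cong-≗ (λ o → incidence-old₁-ι₂ o j)) (sum-replicate-zero k₁))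
                              (sum-cong-≗ (λ o → incidence-old₂-ι₂ o j)))
                   (incidence-new-ι₂ j) ⟩
    old + incidence G₂ e₂ j                                    ≡⟨ +-comm old (incidence G₂ e₂ j) ⟩
    incidence G₂ e₂ j + old                                    ≡⟨ sum-remove (λ e → incidence G₂ e j) ⟨
    ∑[ e < suc k₂ ] incidence G₂ e j                           ≡⟨ deg-∑ G₂ j ⟨
    deg G₂ j                                                   ∎
    where
      open ≡-Reasoning
      new = ∑[ f < 4 ] incidence A ((k₁ + k₂) ↑ʳ f) (ι₂ j)
      old = ∑[ o < k₂ ] incidence G₂ (punchIn e₂ o) j

adhesion-pieces-regular : ∀ {k G} G₁ e₁ G₂ e₂ → Regular k G → G ≅ adhesion G₁ e₁ G₂ e₂ → Regular k G₁ × Regular k G₂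
adhesion-pieces-regular {k} record { n = n₁ ; m = suc k₁ ; ends = ends₁ } e₁ record { n = n₂ ; m = suc k₂ ; ends = ends₂ } e₂ reg iso =
  (λ i → trans (sym (deg-ι₁ i)) (via-G (ι₁ i))) , (λ j → trans (sym (deg-ι₂ j)) (via-G (ι₂ j)))
  where
    open Adhesion n₁ k₁ ends₁ e₁ n₂ k₂ ends₂ e₂
    σ = _≅_.vmap iso
    via-G : ∀ u → deg A u ≡ k
    via-G u = trans (cong (deg A) (sym (Inverse.strictlyInverseˡ σ u))) (trans (deg-≅ iso (Inverse.from σ u)) (reg _))

⟦_⟧ : ∀ {n} {P : Pred (Fin n) ℓ} → Decidable P → Subset n
⟦ P? ⟧ = tabulate (does ∘ P?)

∈⟦⟧⁺ : ∀ {n} {P : Pred (Fin n) ℓ} (P? : Decidable P) {x} → P x → x ∈ ⟦ P? ⟧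
∈⟦⟧⁺ P? {x} px = lookup⇒[]= x _ (trans (lookup∘tabulate (does ∘ P?) x) (dec-true (P? x) px))

∈⟦⟧⁻ : ∀ {n} {P : Pred (Fin n) ℓ} (P? : Decidable P) {x} → x ∈ ⟦ P? ⟧ → P x
∈⟦⟧⁻ P? {x} x∈ with P? x | trans (sym (lookup∘tabulate (does ∘ P?) x)) ([]=⇒lookup x∈)
... | yes px | _ = px
... | no _ | ()

extensive⇒fixpoint : ∀ {n} (F : Subset n → Subset n) → (∀ p → p ⊆ F p) →
  (I : Pred (Subset n) ℓ) → (∀ {p} → I p → I (F p)) →
  ∀ {p} → I p → ∃[ q ] (I q × F q ⊆ q)
extensive⇒fixpoint {n = n} F extensive I preserved {p} = ascend (suc n) (s≤s (m≤m+n n ∣ p ∣))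
  where
    ascend : ∀ k {p} → n < k + ∣ p ∣ → I p → ∃[ q ] (I q × F q ⊆ q)
    ascend zero    {p} n<∣p∣ _ = contradiction (∣p∣≤n p) (<⇒≱ n<∣p∣)
    ascend (suc k) {p} n<1+k+∣p∣ Ip with p ⊂? F p
    ... | yes p⊂Fp = ascend k (≤-trans n<1+k+∣p∣ bound) (preserved Ip)
      where
        bound : suc (k + ∣ p ∣) ≤ k + ∣ F p ∣
        bound = ≤-trans (≤-reflexive (sym (+-suc k ∣ p ∣))) (+-monoʳ-≤ k (p⊂q⇒∣p∣<∣q∣ p⊂Fp))
    ... | no p⊄Fp  = p , Ip , λ {x} x∈Fp →
      decidable-stable (x ∈? p) (λ x∉p → p⊄Fp (extensive p , x , x∈Fp , x∉p))

record Enumeration {n} (P : Pred (Fin n) 0ℓ) (k : ℕ) : Set where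
  field
    elem       : Fin k → Fin n
    elem-P     : ∀ i → P (elem i)
    index      : ∀ {u} → .(P u) → Fin k
    elem-index : ∀ {u} .(p : P u) → elem (index p) ≡ u
    index-elem : ∀ i → index (elem-P i) ≡ i

enumerate : ∀ {n} {P : Pred (Fin n) 0ℓ} (P? : Decidable P) → Enumeration P (count P?)
enumerate {zero}  P? = record { elem = λ () ; elem-P = λ () ; index = λ { {()} } ; elem-index = λ { {()} } ; index-elem = λ () }
enumerate {suc n} {P} P? = extend (P? zero) (enumerate (P? ∘ suc))
  where
    extend : ∀ {k} (d : Dec (P zero)) → Enumeration (P ∘ suc) k → Enumeration P (𝟙 d + k)
    extend (yes Pz) E = record
      { elem = λ { zero → zero ; (suc i) → suc (elem i) }
      ; elem-P = λ { zero → Pz ; (suc i) → elem-P i }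
      ; index = λ { {zero} _ → zero ; {suc u} p → suc (index p) }
      ; elem-index = λ { {zero} _ → refl ; {suc u} p → cong suc (elem-index p) }
      ; index-elem = λ { zero → refl ; (suc i) → cong suc (index-elem i) }
      }
      where open Enumeration E
    extend (no ¬Pz) E = record
      { elem = suc ∘ elem
      ; elem-P = elem-P
      ; index = λ { {zero} p → Irrelevant.⊥-elim (¬Pz p) ; {suc u} p → index p }
      ; elem-index = λ { {zero} p → Irrelevant.⊥-elim (¬Pz p) ; {suc u} p → cong suc (elem-index p) }
      ; index-elem = index-elem
      }
      where open Enumeration E

-- Walks and components

Reach-snoc : ∀ {G P x y z} → Reach G P x y → Adj G y z → P z → Reach G P x z
Reach-snoc here               y~z Pz = step y~z Pz here
Reach-snoc (step x~w Pw w⇝y) y~z Pz = step x~w Pw (Reach-snoc w⇝y y~z Pz)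

Reach-crosses : ∀ {G P} {X : Pred (Fin (n G)) ℓ} → Decidable X → ∀ {p q} → Reach G P p q → X p → ¬ X q →
  ∃[ u ] ∃[ z ] (X u × ¬ X z × Adj G u z)
Reach-crosses X? here Xp ¬Xq = contradiction Xp ¬Xq
Reach-crosses X? (step {z = z} p~z _ z⇝q) Xp ¬Xq with X? z
... | yes Xz  = Reach-crosses X? z⇝q Xz ¬Xq
... | no ¬Xz = _ , z , Xp , ¬Xz , p~z

module Component (G : Graph) (v : Fin (n G)) where

  private
    a b : Fin (m G) → Fin (n G)
    a e = proj₁ (ends G e)
    b e = proj₂ (ends G e)

  Frontier : Subset (n G) → Pred (Fin (n G)) _
  Frontier p z = z ≢ v × ∃[ e ] ((a e ∈ p × b e ≡ z) ⊎ (b e ∈ p × a e ≡ z))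

  frontier? : ∀ p → Decidable (Frontier p)
  frontier? p z = ¬? (z ≟ v) ×-dec any? λ e → (a e ∈? p ×-dec b e ≟ z) ⊎-dec (b e ∈? p ×-dec a e ≟ z)

  grow : Subset (n G) → Subset (n G)
  grow p = p ∪ ⟦ frontier? p ⟧

  ReachedFrom : Fin (n G) → Pred (Subset (n G)) _
  ReachedFrom x p = x ∈ p × (∀ {u} → u ∈ p → Reach G (_≢ v) x u)

  grow-reached : ∀ {x p} → ReachedFrom x p → ReachedFrom x (grow p)
  grow-reached {x} {p} (x∈p , reached) = p⊆p∪q _ x∈p , reached′
    where
      reached′ : ∀ {u} → u ∈ grow p → Reach G (_≢ v) x u
      reached′ {u} u∈ with x∈p∪q⁻ p _ u∈
      ... | inj₁ u∈p = reached u∈p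
      ... | inj₂ u∈F with ∈⟦⟧⁻ (frontier? p) u∈F
      ... | u≢v , e , inj₁ (ae∈p , be≡u) = Reach-snoc (reached ae∈p) (e , inj₁ (cong (a e ,_) be≡u)) u≢v
      ... | u≢v , e , inj₂ (be∈p , ae≡u) = Reach-snoc (reached be∈p) (e , inj₂ (cong (_, b e) ae≡u)) u≢v

  component : ∀ x → ∃[ C ] (ReachedFrom x C × grow C ⊆ C)
  component x = extensive⇒fixpoint grow (λ p → p⊆p∪q _) (ReachedFrom x) grow-reached
    (x∈⁅x⁆ x , λ u∈ → subst (Reach G _ x) (sym (x∈⁅y⁆⇒x≡y x u∈)) here)

  grown-closed : ∀ {C u z} → grow C ⊆ C → u ∈ C → Adj G u z → z ≢ v → z ∈ C
  grown-closed {C} closed u∈C (e , inj₁ e≡uz) z≢v =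
    closed (q⊆p∪q C _ (∈⟦⟧⁺ (frontier? C) (z≢v , e , inj₁ (subst (_∈ C) (sym (cong proj₁ e≡uz)) u∈C , cong proj₂ e≡uz))))
  grown-closed {C} closed u∈C (e , inj₂ e≡zu) z≢v =
    closed (q⊆p∪q C _ (∈⟦⟧⁺ (frontier? C) (z≢v , e , inj₂ (subst (_∈ C) (sym (cong proj₂ e≡zu)) u∈C , cong proj₁ e≡zu))))

-- Separations at a cut vertex

data Side : Set where
  left right : Side

data Part : Set where
  cut  : Part
  side : Side → Part

data Kind : Set where
  internal attaching : Side → Kind
  loop               : Kind

-- The edges that can occur once no edge joins the two sides.
data EdgeType : Part → Part → Set where
  internal : ∀ s → EdgeType (side s) (side s)
  outward  : ∀ s → EdgeType (side s) cut
  inward   : ∀ s → EdgeType cut (side s)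
  loop     : EdgeType cut cut

_≟ˢ_ : DecidableEquality Side
left  ≟ˢ left  = yes refl
left  ≟ˢ right = no λ ()
right ≟ˢ left  = no λ ()
right ≟ˢ right = yes refl

_≟ᵖ_ : DecidableEquality Part
cut    ≟ᵖ cut     = yes refl
cut    ≟ᵖ side _  = no λ ()
side _ ≟ᵖ cut     = no λ ()
side s ≟ᵖ side s′ = map′ (cong side) (λ { refl → refl }) (s ≟ˢ s′)

_≟ᵏ_ : DecidableEquality Kind
internal s  ≟ᵏ internal s′  = map′ (cong internal) (λ { refl → refl }) (s ≟ˢ s′)
attaching s ≟ᵏ attaching s′ = map′ (cong attaching) (λ { refl → refl }) (s ≟ˢ s′)
loop        ≟ᵏ loop         = yes refl
internal _  ≟ᵏ attaching _  = no λ ()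
internal _  ≟ᵏ loop         = no λ ()
attaching _ ≟ᵏ internal _   = no λ ()
attaching _ ≟ᵏ loop         = no λ ()
loop        ≟ᵏ internal _   = no λ ()
loop        ≟ᵏ attaching _  = no λ ()

kind : ∀ {p q} → EdgeType p q → Kind
kind (internal s) = internal s
kind (outward s)  = attaching s
kind (inward s)   = attaching s
kind loop         = loop

side-ends : ∀ s {p q} (t : EdgeType p q) →
  𝟙 (p ≟ᵖ side s) + 𝟙 (q ≟ᵖ side s) ≡ 2 * 𝟙 (kind t ≟ᵏ internal s) + 𝟙 (kind t ≟ᵏ attaching s)
side-ends left  (internal left)  = refl
side-ends left  (internal right) = refl
side-ends right (internal left)  = refl
side-ends right (internal right) = refl
side-ends left  (outward left)   = refl
side-ends left  (outward right)  = refl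
side-ends right (outward left)   = refl
side-ends right (outward right)  = refl
side-ends left  (inward left)    = refl
side-ends left  (inward right)   = refl
side-ends right (inward left)    = refl
side-ends right (inward right)   = refl
side-ends left  loop             = refl
side-ends right loop             = refl

cut-ends : ∀ {p q} (t : EdgeType p q) →
  𝟙 (p ≟ᵖ cut) + 𝟙 (q ≟ᵖ cut) ≡ 2 * 𝟙 (kind t ≟ᵏ loop) + 𝟙 (kind t ≟ᵏ attaching left) + 𝟙 (kind t ≟ᵏ attaching right)
cut-ends (internal left)  = refl
cut-ends (internal right) = refl
cut-ends (outward left)   = refl
cut-ends (outward right)  = refl
cut-ends (inward left)    = refl
cut-ends (inward right)   = refl
cut-ends loop             = refl

internal-parts : ∀ {s p q} (t : EdgeType p q) → kind t ≡ internal s → p ≡ side s × q ≡ side s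
internal-parts (internal s) refl = refl , refl

attaching-parts : ∀ {s p q} (t : EdgeType p q) → kind t ≡ attaching s →
  (p ≡ side s × q ≡ cut) ⊎ (p ≡ cut × q ≡ side s)
attaching-parts (outward s) refl = inj₁ (refl , refl)
attaching-parts (inward s)  refl = inj₂ (refl , refl)

leaving-attaching : ∀ {s p q} (t : EdgeType p q) → p ≡ side s → q ≢ side s → kind t ≡ attaching s
leaving-attaching (internal s) refl q≢s = contradiction refl q≢s
leaving-attaching (outward s)  refl _   = refl

entering-attaching : ∀ {s p q} (t : EdgeType p q) → q ≡ side s → p ≢ side s → kind t ≡ attaching s
entering-attaching (internal s) refl p≢s = contradiction refl p≢s
entering-attaching (inward s)   refl _   = refl

noncrossing : ∀ {p q} → (p ≡ side left → q ≢ side right) → (q ≡ side left → p ≢ side right) → EdgeType p q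
noncrossing {cut}          {cut}          _ _ = loop
noncrossing {cut}          {side s}       _ _ = inward s
noncrossing {side s}       {cut}          _ _ = outward s
noncrossing {side left}    {side left}    _ _ = internal left
noncrossing {side right}   {side right}   _ _ = internal right
noncrossing {side left}    {side right}   l↛r _ = contradiction refl (l↛r refl)
noncrossing {side right}   {side left}    _ l↛r = contradiction refl (l↛r refl)

record Separation (G : Graph) : Set where
  field
    part       : Fin (n G) → Part
    cutVertex  : Fin (n G)
    part-cut   : ∀ {u} → part u ≡ cut → u ≡ cutVertex
    cutVertex-cut : part cutVertex ≡ cut
    edgeType   : ∀ e → EdgeType (part (proj₁ (ends G e))) (part (proj₂ (ends G e)))
    inhabited  : ∀ s → ∃[ u ] part u ≡ side s

module _ {G : Graph} {v : Fin (n G)} {C : Subset (n G)} where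

  data Placed (u : Fin (n G)) : Part → Set where
    at-cut    : u ≡ v → Placed u cut
    inside-C  : u ≢ v → u ∈ C → Placed u (side left)
    outside-C : u ≢ v → u ∉ C → Placed u (side right)

  place : ∀ u → ∃ (Placed u)
  place u with u ≟ v | u ∈? C
  ... | yes u≡v | _       = cut , at-cut u≡v
  ... | no u≢v  | yes u∈C = side left , inside-C u≢v u∈C
  ... | no u≢v  | no u∉C  = side right , outside-C u≢v u∉C

  placed-unique : ∀ {u p q} → Placed u p → Placed u q → p ≡ q
  placed-unique (at-cut _)        (at-cut _)        = refl
  placed-unique (at-cut u≡v)      (inside-C u≢v _)  = contradiction u≡v u≢v
  placed-unique (at-cut u≡v)      (outside-C u≢v _) = contradiction u≡v u≢v
  placed-unique (inside-C u≢v _)  (at-cut u≡v)      = contradiction u≡v u≢v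
  placed-unique (inside-C _ _)    (inside-C _ _)    = refl
  placed-unique (inside-C _ u∈C)  (outside-C _ u∉C) = contradiction u∈C u∉C
  placed-unique (outside-C u≢v _) (at-cut u≡v)      = contradiction u≡v u≢v
  placed-unique (outside-C _ u∉C) (inside-C _ u∈C)  = contradiction u∈C u∉C
  placed-unique (outside-C _ _)   (outside-C _ _)   = refl

  separation : (∀ {u z} → u ∈ C → Adj G u z → z ≢ v → z ∈ C) →
    ∀ {x y} → x ≢ v → x ∈ C → y ≢ v → y ∉ C → Separation G
  separation closed {x} {y} x≢v x∈C y≢v y∉C = record
    { part          = part
    ; cutVertex     = v
    ; part-cut      = at-cut⁻¹ ∘ placed-at
    ; cutVertex-cut = placed-unique (placed v) (at-cut refl)
    ; edgeType      = λ e → noncrossing (no-crossing (e , inj₁ refl)) (no-crossing (e , inj₂ refl))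
    ; inhabited     = λ { left  → x , placed-unique (placed x) (inside-C x≢v x∈C)
                        ; right → y , placed-unique (placed y) (outside-C y≢v y∉C) }
    }
    where
      part : Fin (n G) → Part
      part u = proj₁ (place u)
      placed : ∀ u → Placed u (part u)
      placed u = proj₂ (place u)
      placed-at : ∀ {u p} → part u ≡ p → Placed u p
      placed-at {u} eq = subst (Placed u) eq (placed u)
      at-cut⁻¹ : ∀ {u} → Placed u cut → u ≡ v
      at-cut⁻¹ (at-cut u≡v) = u≡v
      no-crossing : ∀ {u z} → Adj G u z → part u ≡ side left → part z ≢ side right
      no-crossing {u} {z} u~z u-left z-right with placed-at u-left | placed-at z-right
      ... | inside-C _ u∈C | outside-C z≢v z∉C = z∉C (closed u∈C u~z z≢v)

module _ {G : Graph} where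
  open Component G

  cut-separation : Connected G → ¬ TwoConnected G → Separation G
  cut-separation conn ¬2c
    with any? (λ v → any? (λ x → any? (λ y → ¬? (x ≟ v) ×-dec ¬? (y ≟ v) ×-dec ¬? (y ∈? proj₁ (component v x)))))
  ... | yes (v , x , y , x≢v , y≢v , y∉C) with component v x
  ...   | C , (x∈C , _) , grown = separation (grown-closed v grown) x≢v x∈C y≢v y∉C
  cut-separation conn ¬2c | no unseparated = contradiction (conn , reach) ¬2c
    where
      reach : ∀ v x y → x ≢ v → y ≢ v → Reach G (λ u → u ≢ v) x y
      reach v x y x≢v y≢v = proj₂ (proj₁ (proj₂ (component v x)))
        (decidable-stable (y ∈? proj₁ (component v x)) (λ y∉C → unseparated (v , x , y , x≢v , y≢v , y∉C)))

-- Counting edges at the cut vertex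

4x≡2y+c∧0<c⇒2≤c : ∀ x y c → 4 * x ≡ 2 * y + c → 0 < c → 2 ≤ c
4x≡2y+c∧0<c⇒2≤c x y (suc zero) eq _ =
  contradiction (trans (sym (*-assoc 2 2 x)) (trans eq (+-comm (2 * y) 1))) (even≢odd (2 * x) y)
4x≡2y+c∧0<c⇒2≤c x y (suc (suc c)) eq _ = s≤s (s≤s z≤n)

2l+c+d≡4⇒l≡0∧c≡d≡2 : ∀ l c d → 2 * l + c + d ≡ 4 → 2 ≤ c → 2 ≤ d → l ≡ 0 × c ≡ 2 × d ≡ 2
2l+c+d≡4⇒l≡0∧c≡d≡2 l .(2 + c) .(2 + d) eq (s≤s (s≤s {n = c} _)) (s≤s (s≤s {n = d} _)) =
  double≡0 2l≡0 , cong (2 +_) c≡0 , cong (2 +_) d≡0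
  where
    rearrange : ∀ l c d → 2 * l + (2 + c) + (2 + d) ≡ 4 + (2 * l + c + d)
    rearrange = solve-∀
    rest≡0 : 2 * l + c + d ≡ 0
    rest≡0 = +-cancelˡ-≡ 4 _ 0 (trans (sym (rearrange l c d)) eq)
    2l+c≡0 : 2 * l + c ≡ 0
    2l+c≡0 = m+n≡0⇒m≡0 (2 * l + c) rest≡0
    2l≡0 : 2 * l ≡ 0
    2l≡0 = m+n≡0⇒m≡0 (2 * l) 2l+c≡0
    c≡0 : c ≡ 0
    c≡0 = m+n≡0⇒n≡0 (2 * l) 2l+c≡0
    d≡0 : d ≡ 0
    d≡0 = m+n≡0⇒n≡0 (2 * l + c) rest≡0
    double≡0 : ∀ {l} → 2 * l ≡ 0 → l ≡ 0
    double≡0 {zero} _ = refl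

module Counting (G : Graph) (reg : Regular 4 G) (conn : Connected G) (S : Separation G) where
  open Separation S

  private
    v = cutVertex
    a b : Fin (m G) → Fin (n G)
    a e = proj₁ (ends G e)
    b e = proj₂ (ends G e)

  edgeKind : Fin (m G) → Kind
  edgeKind e = kind (edgeType e)

  order : Side → ℕ
  order s = count (λ u → part u ≟ᵖ side s)

  #edges : Kind → ℕ
  #edges k = count (λ e → edgeKind e ≟ᵏ k)

  side-count : ∀ s → 4 * order s ≡ 2 * #edges (internal s) + #edges (attaching s)
  side-count s = begin
    4 * order s                                ≡⟨ *-distribˡ-sum 4 f ⟩
    ∑[ u < n G ] (4 * f u)                      ≡⟨ sum-cong-≗ (λ u → cong (_* f u) (sym (reg u))) ⟩
    ∑[ u < n G ] (deg G u * f u)                ≡⟨ weighted-handshake G f ⟩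
    ∑[ e < m G ] (f (a e) + f (b e))            ≡⟨ sum-cong-≗ (λ e → side-ends s (edgeType e)) ⟩
    ∑[ e < m G ] (2 * 𝟙 (edgeKind e ≟ᵏ internal s) + 𝟙 (edgeKind e ≟ᵏ attaching s))
      ≡⟨ ∑-distrib-+ (λ e → 2 * 𝟙 (edgeKind e ≟ᵏ internal s)) (λ e → 𝟙 (edgeKind e ≟ᵏ attaching s)) ⟩
    ∑[ e < m G ] (2 * 𝟙 (edgeKind e ≟ᵏ internal s)) + #edges (attaching s)
      ≡⟨ cong (_+ #edges (attaching s)) (*-distribˡ-sum 2 (λ e → 𝟙 (edgeKind e ≟ᵏ internal s))) ⟨
    2 * #edges (internal s) + #edges (attaching s) ∎
    where
      open ≡-Reasoning
      f : Fin (n G) → ℕ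
      f u = 𝟙 (part u ≟ᵖ side s)

  ind-cutVertex : ∀ u → ind u v ≡ 𝟙 (part u ≟ᵖ cut)
  ind-cutVertex u with u ≟ v
  ... | yes refl rewrite cutVertex-cut = refl
  ... | no u≢v   rewrite dec-false (part u ≟ᵖ cut) (u≢v ∘ part-cut) = refl

  cut-count : 2 * #edges loop + #edges (attaching left) + #edges (attaching right) ≡ 4
  cut-count = begin
    2 * #edges loop + #edges (attaching left) + #edges (attaching right)
      ≡⟨ cong₂ _+_ (cong₂ _+_ (*-distribˡ-sum 2 (𝟙k loop)) refl) refl ⟩
    ∑[ e < m G ] (2 * 𝟙k loop e) + #edges (attaching left) + #edges (attaching right)
      ≡⟨ cong (_+ #edges (attaching right)) (∑-distrib-+ (λ e → 2 * 𝟙k loop e) (𝟙k (attaching left))) ⟨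
    ∑[ e < m G ] (2 * 𝟙k loop e + 𝟙k (attaching left) e) + #edges (attaching right)
      ≡⟨ ∑-distrib-+ (λ e → 2 * 𝟙k loop e + 𝟙k (attaching left) e) (𝟙k (attaching right)) ⟨
    ∑[ e < m G ] (2 * 𝟙k loop e + 𝟙k (attaching left) e + 𝟙k (attaching right) e)
      ≡⟨ sum-cong-≗ (λ e → cut-ends (edgeType e)) ⟨
    ∑[ e < m G ] (𝟙 (part (a e) ≟ᵖ cut) + 𝟙 (part (b e) ≟ᵖ cut))
      ≡⟨ sum-cong-≗ (λ e → cong₂ _+_ (ind-cutVertex (a e)) (ind-cutVertex (b e))) ⟨
    ∑[ e < m G ] incidence G e v ≡⟨ deg-∑ G v ⟨
    deg G v ≡⟨ reg v ⟩
    4 ∎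
    where
      open ≡-Reasoning
      𝟙k : Kind → Fin (m G) → ℕ
      𝟙k k e = 𝟙 (edgeKind e ≟ᵏ k)

  #edges-positive : ∀ {e k} → edgeKind e ≡ k → 1 ≤ #edges k
  #edges-positive {e} {k} eq = subst (_≤ #edges k) (cong (λ β → if β then 1 else 0) (dec-true (edgeKind e ≟ᵏ k) eq))
                             (term≤∑ (λ e → 𝟙 (edgeKind e ≟ᵏ k)) e)

  other : Side → Side
  other left  = right
  other right = left

  other-≢ : ∀ s → side (other s) ≢ side s
  other-≢ left  ()
  other-≢ right ()

  attaching-exists : ∀ s → ∃[ e ] edgeKind e ≡ attaching s
  attaching-exists s with inhabited s | inhabited (other s)
  ... | x , x∈s | y , y∈s′ with Reach-crosses (λ u → part u ≟ᵖ side s) (conn x y tt tt) x∈s (other-≢ s ∘ trans (sym y∈s′))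
  ... | u , z , u∈s , z∉s , e , inj₁ e≡uz = e , leaving-attaching (edgeType e)
          (trans (cong (part ∘ proj₁) e≡uz) u∈s) (z∉s ∘ trans (sym (cong (part ∘ proj₂) e≡uz)))
  ... | u , z , u∈s , z∉s , e , inj₂ e≡zu = e , entering-attaching (edgeType e)
          (trans (cong (part ∘ proj₂) e≡zu) u∈s) (z∉s ∘ trans (sym (cong (part ∘ proj₁) e≡zu)))

  attaching-≥2 : ∀ s → 2 ≤ #edges (attaching s)
  attaching-≥2 s = 4x≡2y+c∧0<c⇒2≤c (order s) (#edges (internal s)) (#edges (attaching s)) (side-count s)
                                 (#edges-positive (proj₂ (attaching-exists s)))

  cut-edge-counts : #edges loop ≡ 0 × #edges (attaching left) ≡ 2 × #edges (attaching right) ≡ 2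
  cut-edge-counts = 2l+c+d≡4⇒l≡0∧c≡d≡2 (#edges loop) _ _ cut-count (attaching-≥2 left) (attaching-≥2 right)

  attaching-two : ∀ s → #edges (attaching s) ≡ 2
  attaching-two left  = proj₁ (proj₂ cut-edge-counts)
  attaching-two right = proj₂ (proj₂ cut-edge-counts)

  no-loop : ∀ e → edgeKind e ≢ loop
  no-loop e eq with subst (1 ≤_) (proj₁ cut-edge-counts) (#edges-positive eq)
  ... | ()

-- The decomposition

module Decomposition (G : Graph) (reg : Regular 4 G) (conn : Connected G) (S : Separation G) where
  open Separation S
  open Counting G reg conn S

  private
    v = cutVertex
    a b : Fin (m G) → Fin (n G)
    a e = proj₁ (ends G e)
    b e = proj₂ (ends G e)

  sideEnd : Side → Fin (m G) → Fin (n G)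
  sideEnd s e = if does (part (a e) ≟ᵖ side s) then a e else b e

  sideEnd-ends : ∀ {s e} → edgeKind e ≡ attaching s →
    part (sideEnd s e) ≡ side s × (ends G e ≡ (sideEnd s e , v) ⊎ ends G e ≡ (v , sideEnd s e))
  sideEnd-ends {s} {e} att with attaching-parts (edgeType e) att
  ... | inj₁ (a∈s , b-cut) rewrite dec-true (part (a e) ≟ᵖ side s) a∈s =
          a∈s , inj₁ (cong (a e ,_) (part-cut b-cut))
  ... | inj₂ (a-cut , b∈s) rewrite dec-false (part (a e) ≟ᵖ side s) (λ a∈s → contradiction (trans (sym a-cut) a∈s) λ ()) =
          b∈s , inj₂ (cong (_, b e) (part-cut a-cut))

  vertices : ∀ s → Enumeration (λ u → part u ≡ side s) (order s)
  vertices s = enumerate (λ u → part u ≟ᵖ side s)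

  internals : ∀ s → Enumeration (λ e → edgeKind e ≡ internal s) (#edges (internal s))
  internals s = enumerate (λ e → edgeKind e ≟ᵏ internal s)

  attachments : ∀ s → Enumeration (λ e → edgeKind e ≡ attaching s) 2
  attachments s = subst (Enumeration _) (attaching-two s) (enumerate (λ e → edgeKind e ≟ᵏ attaching s))

  module V (s : Side) = Enumeration (vertices s)
  module I (s : Side) = Enumeration (internals s)
  module At (s : Side) = Enumeration (attachments s)

  sideEndIndex : (s : Side) → Fin 2 → Fin (order s)
  sideEndIndex s f = V.index s (proj₁ (sideEnd-ends (At.elem-P s f)))

  pieceEnds : ∀ s → Fin (suc (#edges (internal s))) → Fin (order s) × Fin (order s)
  pieceEnds s zero    = sideEndIndex s zero , sideEndIndex s (suc zero)
  pieceEnds s (suc i) = V.index s (proj₁ inside) , V.index s (proj₂ inside)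
    where inside = internal-parts (edgeType (I.elem s i)) (I.elem-P s i)

  piece : Side → Graph
  piece s = record { n = order s ; m = suc (#edges (internal s)) ; ends = pieceEnds s }

  Vertex : Set
  Vertex = Fin (suc (order left + order right))

  ι : ∀ s → Fin (order s) → Vertex
  ι left  i = suc (i ↑ˡ order right)
  ι right j = suc (order left ↑ʳ j)

  -- σ′ and τ′ (below) take the equation as an argument: lemmas then case on the part (kind) by
  -- generalising it, whereas with-abstraction over `part u in eq` would be ill-typed.
  σ′ : ∀ u {p} → part u ≡ p → Vertex
  σ′ u {cut}    _  = zero
  σ′ u {side s} u∈ = ι s (V.index s u∈)

  σ : Fin (n G) → Vertex
  σ u = σ′ u refl

  σ′≡σ : ∀ {u p} (eq : part u ≡ p) → σ′ u eq ≡ σ u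
  σ′≡σ refl = refl

  σ-cut : ∀ {u} → part u ≡ cut → σ u ≡ zero
  σ-cut u-cut = sym (σ′≡σ u-cut)

  σ-side : ∀ {u s} (u∈s : part u ≡ side s) → σ u ≡ ι s (V.index s u∈s)
  σ-side u∈s = sym (σ′≡σ u∈s)

  σ⁻¹ : Vertex → Fin (n G)
  σ⁻¹ zero    = v
  σ⁻¹ (suc j) = [ V.elem left , V.elem right ] (splitAt (order left) j)

  σ⁻¹-ι : ∀ s i → σ⁻¹ (ι s i) ≡ V.elem s i
  σ⁻¹-ι left  i = cong [ V.elem left , V.elem right ] (splitAt-↑ˡ (order left) i (order right))
  σ⁻¹-ι right j = cong [ V.elem left , V.elem right ] (splitAt-↑ʳ (order left) (order right) j)

  σ⁻¹∘σ′ : ∀ {u p} (eq : part u ≡ p) → σ⁻¹ (σ′ u eq) ≡ u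
  σ⁻¹∘σ′ {p = cut}    u-cut = sym (part-cut u-cut)
  σ⁻¹∘σ′ {p = side s} u∈s   = trans (σ⁻¹-ι s _) (V.elem-index s u∈s)

  σ⁻¹∘σ : ∀ u → σ⁻¹ (σ u) ≡ u
  σ⁻¹∘σ u = σ⁻¹∘σ′ refl

  σ∘ι : ∀ s i → σ (V.elem s i) ≡ ι s i
  σ∘ι s i = trans (σ-side (V.elem-P s i)) (cong (ι s) (V.index-elem s i))

  σ∘σ⁻¹ : ∀ j → σ (σ⁻¹ j) ≡ j
  σ∘σ⁻¹ zero = σ-cut cutVertex-cut
  σ∘σ⁻¹ (suc j) with splitAt (order left) j in j≡
  ... | inj₁ i = trans (σ∘ι left i) (cong suc (splitAt⁻¹-↑ˡ j≡))
  ... | inj₂ i = trans (σ∘ι right i) (cong suc (splitAt⁻¹-↑ʳ j≡))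

  vertexMap : Fin (n G) ↔ Vertex
  vertexMap = mk↔ₛ′ σ σ⁻¹ σ∘σ⁻¹ σ⁻¹∘σ

  #old : ℕ
  #old = #edges (internal left) + #edges (internal right)

  Edge : Set
  Edge = Fin (#old + 4)

  old : ∀ s → Fin (#edges (internal s)) → Edge
  old left  i = (i ↑ˡ #edges (internal right)) ↑ˡ 4
  old right j = (#edges (internal left) ↑ʳ j) ↑ˡ 4

  new : (s : Side) → Fin 2 → Edge
  new left  f = #old ↑ʳ (f ↑ˡ 2)
  new right f = #old ↑ʳ (2 ↑ʳ f)

  τ′ : ∀ e {k} → edgeKind e ≡ k → Edge
  τ′ e {internal s}  e∈ = old s (I.index s e∈)
  τ′ e {attaching s} e∈ = new s (At.index s e∈)
  τ′ e {loop}        e∈ = contradiction e∈ (no-loop e)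

  τ : Fin (m G) → Edge
  τ e = τ′ e refl

  τ′≡τ : ∀ {e k} (eq : edgeKind e ≡ k) → τ′ e eq ≡ τ e
  τ′≡τ refl = refl

  τ⁻¹ : Edge → Fin (m G)
  τ⁻¹ j = [ (λ o → [ I.elem left , I.elem right ] (splitAt (#edges (internal left)) o))
          , (λ f → [ At.elem left , At.elem right ] (splitAt 2 f)) ]
          (splitAt #old j)

  τ⁻¹-old : ∀ s i → τ⁻¹ (old s i) ≡ I.elem s i
  τ⁻¹-old left  i rewrite splitAt-↑ˡ #old (i ↑ˡ #edges (internal right)) 4
                        | splitAt-↑ˡ (#edges (internal left)) i (#edges (internal right)) = refl
  τ⁻¹-old right j rewrite splitAt-↑ˡ #old (#edges (internal left) ↑ʳ j) 4
                        | splitAt-↑ʳ (#edges (internal left)) (#edges (internal right)) j = refl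

  τ⁻¹-new : ∀ (s : Side) f → τ⁻¹ (new s f) ≡ At.elem s f
  τ⁻¹-new left  f rewrite splitAt-↑ʳ #old 4 (f ↑ˡ 2)
                        | splitAt-↑ˡ 2 f 2 = refl
  τ⁻¹-new right f rewrite splitAt-↑ʳ #old 4 (2 ↑ʳ f)
                        | splitAt-↑ʳ 2 2 f = refl

  τ⁻¹∘τ′ : ∀ {e k} (eq : edgeKind e ≡ k) → τ⁻¹ (τ′ e eq) ≡ e
  τ⁻¹∘τ′ {e} {internal s}  e∈ = trans (τ⁻¹-old s _) (I.elem-index s e∈)
  τ⁻¹∘τ′ {e} {attaching s} e∈ = trans (τ⁻¹-new s _) (At.elem-index s e∈)
  τ⁻¹∘τ′ {e} {loop}        e∈ = contradiction e∈ (no-loop e)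

  τ∘old : ∀ s i → τ (I.elem s i) ≡ old s i
  τ∘old s i = trans (sym (τ′≡τ (I.elem-P s i))) (cong (old s) (I.index-elem s i))

  τ∘new : ∀ (s : Side) f → τ (At.elem s f) ≡ new s f
  τ∘new s f = trans (sym (τ′≡τ (At.elem-P s f))) (cong (new s) (At.index-elem s f))

  τ∘τ⁻¹ : ∀ j → τ (τ⁻¹ j) ≡ j
  τ∘τ⁻¹ j with splitAt #old j in j≡
  ... | inj₁ o with splitAt (#edges (internal left)) o in o≡
  ...   | inj₁ i = trans (τ∘old left i) (trans (cong (_↑ˡ 4) (splitAt⁻¹-↑ˡ o≡)) (splitAt⁻¹-↑ˡ j≡))
  ...   | inj₂ i = trans (τ∘old right i) (trans (cong (_↑ˡ 4) (splitAt⁻¹-↑ʳ o≡)) (splitAt⁻¹-↑ˡ j≡))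
  τ∘τ⁻¹ j | inj₂ f with splitAt 2 f in f≡
  ...   | inj₁ i = trans (τ∘new left i) (trans (cong (_ ↑ʳ_) (splitAt⁻¹-↑ˡ f≡)) (splitAt⁻¹-↑ʳ j≡))
  ...   | inj₂ i = trans (τ∘new right i) (trans (cong (_ ↑ʳ_) (splitAt⁻¹-↑ʳ f≡)) (splitAt⁻¹-↑ʳ j≡))

  edgeMap : Fin (m G) ↔ Edge
  edgeMap = mk↔ₛ′ τ τ⁻¹ τ∘τ⁻¹ (λ e → τ⁻¹∘τ′ refl)

  open Adhesion (order left) (#edges (internal left)) (pieceEnds left) zero
                (order right) (#edges (internal right)) (pieceEnds right) zero
    using (A; ends-old₁; ends-old₂; ends-new)

  ends-old : ∀ s i → ends A (old s i) ≡ (ι s (proj₁ (pieceEnds s (suc i))) , ι s (proj₂ (pieceEnds s (suc i))))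
  ends-old left  = ends-old₁
  ends-old right = ends-old₂

  ends-attach : ∀ s f → ends A (new s f) ≡ (ι s (sideEndIndex s f) , zero)
  ends-attach left  zero       = ends-new zero
  ends-attach left  (suc zero) = ends-new (suc zero)
  ends-attach right zero       = ends-new (suc (suc zero))
  ends-attach right (suc zero) = ends-new (suc (suc (suc zero)))

  ι-index : ∀ {s w u} (w∈s : part w ≡ side s) → w ≡ u → ι s (V.index s w∈s) ≡ σ u
  ι-index w∈s refl = sym (σ-side w∈s)

  σ-cutVertex : zero ≡ σ v
  σ-cutVertex = sym (σ-cut cutVertex-cut)

  ends-τ-attaching : ∀ {e s} (e∈ : edgeKind e ≡ attaching s) → ends A (τ e) ≡ (σ (sideEnd s e) , σ v)
  ends-τ-attaching {e} {s} e∈ = begin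
    ends A (τ e)                                  ≡⟨ cong (ends A) (τ′≡τ e∈) ⟨
    ends A (new s f)                              ≡⟨ ends-attach s f ⟩
    (ι s (sideEndIndex s f) , zero)
      ≡⟨ cong₂ _,_ (ι-index (proj₁ (sideEnd-ends (At.elem-P s f))) (cong (sideEnd s) (At.elem-index s e∈))) σ-cutVertex ⟩
    (σ (sideEnd s e) , σ v)                       ∎
    where
      open ≡-Reasoning
      f = At.index s e∈

  Preserved : Fin (m G) → Set
  Preserved e = ends A (τ e) ≡ (σ (a e) , σ (b e)) ⊎ ends A (τ e) ≡ (σ (b e) , σ (a e))

  preserved′ : ∀ {e k} (eq : edgeKind e ≡ k) → Preserved e
  preserved′ {e} {internal s} e∈ = inj₁ (begin
    ends A (τ e)                         ≡⟨ cong (ends A) (τ′≡τ e∈) ⟨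
    ends A (old s i)                     ≡⟨ ends-old s i ⟩
    (ι s (V.index s (proj₁ inside)) , ι s (V.index s (proj₂ inside)))
      ≡⟨ cong₂ _,_ (ι-index (proj₁ inside) (cong a e′≡e)) (ι-index (proj₂ inside) (cong b e′≡e)) ⟩
    (σ (a e) , σ (b e))                  ∎)
    where
      open ≡-Reasoning
      i = I.index s e∈
      inside = internal-parts (edgeType (I.elem s i)) (I.elem-P s i)
      e′≡e = I.elem-index s e∈
  preserved′ {e} {attaching s} e∈ with sideEnd-ends e∈
  ... | _ , inj₁ e≡fv = inj₁ (trans (ends-τ-attaching e∈) (cong (λ p → σ (proj₁ p) , σ (proj₂ p)) (sym e≡fv)))
  ... | _ , inj₂ e≡vf = inj₂ (trans (ends-τ-attaching e∈) (cong (λ p → σ (proj₂ p) , σ (proj₁ p)) (sym e≡vf)))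
  preserved′ {e} {loop} e∈ = contradiction e∈ (no-loop e)

  decomposition : G ≅ adhesion (piece left) zero (piece right) zero
  decomposition = record { vmap = vertexMap ; emap = edgeMap ; pres = λ e → preserved′ refl }

lemma6 : (G : Graph) → Regular 4 G → Connected G → ¬ TwoConnected G →
    Σ Graph λ G1 → Σ Graph λ G2 → Regular 4 G1 × Regular 4 G2 ×
    Σ (Fin (m G1)) λ e1 → Σ (Fin (m G2)) λ e2 → G ≅ adhesion G1 e1 G2 e2
lemma6 G reg conn ¬2c =
  piece left , piece right , proj₁ regular , proj₂ regular , zero , zero , decomposition
  where
    open Decomposition G reg conn (cut-separation conn ¬2c)
    regular : Regular 4 (piece left) × Regular 4 (piece right)
    regular = adhesion-pieces-regular (piece left) zero (piece right) zero reg decomposition
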